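{- Let $f(z)\in\mathbb{Z}[z]$ be a polynomial with $f(k)\ne0$ for all nonnegative integers $k$. Then for every prime $p$ there is a positive constant $C$, depending on $f$ and $p$, such that for all positive integers $n$, $v_p\big(\prod_{k=0}^{n-1}f(k)\big)\le Cn$.
   Context: $v_p$ is the $p$-adic valuation. -}

module Defs where

open import Data.Nat using (ℕ; zero; suc; _^_)
open import Data.Integer using (ℤ; +_; _+_; _*_; 1ℤ; 0ℤ)
open import Data.Integer.Divisibility using (_∣_)
open import Data.List using (List; []; _∷_)
open import Data.Product using (_×_)
open import Relation.Nullary using (¬_)

-- A polynomial in ℤ[z], as its coefficient list [a₀, a₁, …, a_d]
-- (f(z) = a₀ + a₁ z + … + a_d z^d).
Poly : Set
Poly = List ℤ

eval : Poly → ℤ → ℤ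
eval []       z = 0ℤ
eval (a ∷ as) z = a + z * eval as z

prodUpTo : Poly → ℕ → ℤ
prodUpTo f zero    = 1ℤ
prodUpTo f (suc n) = prodUpTo f n * eval f (+ n)

-- v is the p-adic valuation of the integer m : p^v ∣ m and p^(v+1) ∤ m.
-- (For m ≠ 0 and p prime such v exists and is unique.)
IsPadicVal : ℕ → ℤ → ℕ → Set
IsPadicVal p m v = ((+ (p ^ v)) ∣ m) × ¬ ((+ (p ^ suc v)) ∣ m)

module Submission where

-- Replace f by a polynomial g with the same values, of degree d, with leading
-- coefficient a ≠ 0; put B = |a| and D = d(d + 1)/2.
--  1. Key estimate: if p^j divides g at d + 1 points whose pairwise differences have
--     valuation ≤ m, then j ≤ B + D·m, because interpolation at those points gives
--     p^j ∣ a · ∏_{i<l} (k_l - k_i).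
--  2. So for j > B + D·m the k with p^j ∣ g(k) meet at most d residue classes mod
--     p^(m+1), and the layer N_j(n) = #{k < n : p^j ∣ g(k)} is ≤ (⌊n/p^(m+1)⌋ + 1)·d.
--  3. v_p(∏_{k<n} g(k)) = Σ_j N_j(n).  The layers j ≤ B contribute ≤ B·n; the others
--     form blocks of D + 1 consecutive layers, block m lying above B + D·m, and M
--     blocks contribute ≤ (D + 1)·d·Σ_{m<M} (⌊n/p^(m+1)⌋ + 1) ≤ (D + 1)·d·(M + n).
--  4. Since |g(k)| < p^((k+1)·K) for a constant K, only M = n·K blocks are needed.

open import Defs
open import Data.Nat using (ℕ; suc; _≤_; NonTrivial)
open import Data.Nat.Primality using (Prime)
open import Data.Integer using (0ℤ)
open import Data.List using (length)
open import Relation.Binary.PropositionalEquality using (_≢_)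

module FiniteSums where

  open import Data.Nat using (ℕ; zero; suc; _+_; _*_; _∸_; _≤_; _<_; z≤n; s≤s)
  open import Data.Nat.Properties
  open import Relation.Nullary using (Dec; yes; no)
  open import Relation.Binary.PropositionalEquality
  open import Data.Nat.Tactic.RingSolver using (solve-∀)

  ∑< : ℕ → (ℕ → ℕ) → ℕ
  ∑< zero    F = 0
  ∑< (suc n) F = ∑< n F + F n

  syntax ∑< n (λ i → e) = ∑[ i < n ] e

  𝟙 : {P : Set} → Dec P → ℕ
  𝟙 (yes _) = 1
  𝟙 (no _)  = 0

  𝟙≤1 : {P : Set} (d : Dec P) → 𝟙 d ≤ 1
  𝟙≤1 (yes _) = s≤s z≤n
  𝟙≤1 (no _)  = z≤n

  ∑-cong : ∀ n {F G : ℕ → ℕ} → (∀ i → i < n → F i ≡ G i) → ∑< n F ≡ ∑< n G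
  ∑-cong zero    eq = refl
  ∑-cong (suc n) eq = cong₂ _+_ (∑-cong n (λ i i<n → eq i (m<n⇒m<1+n i<n))) (eq n ≤-refl)

  ∑-mono : ∀ n {F G : ℕ → ℕ} → (∀ i → i < n → F i ≤ G i) → ∑< n F ≤ ∑< n G
  ∑-mono zero    le = z≤n
  ∑-mono (suc n) le = +-mono-≤ (∑-mono n (λ i i<n → le i (m<n⇒m<1+n i<n))) (le n ≤-refl)

  ∑-const : ∀ n c → ∑[ i < n ] c ≡ n * c
  ∑-const zero    c = refl
  ∑-const (suc n) c = trans (cong (_+ c) (∑-const n c)) (+-comm (n * c) c)

  ∑-≤-const : ∀ n c (F : ℕ → ℕ) → (∀ i → i < n → F i ≤ c) → ∑< n F ≤ n * c
  ∑-≤-const n c F le = ≤-trans (∑-mono n le) (≤-reflexive (∑-const n c))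

  ∑-*ˡ : ∀ n c (F : ℕ → ℕ) → ∑[ i < n ] (c * F i) ≡ c * ∑< n F
  ∑-*ˡ zero    c F = sym (*-zeroʳ c)
  ∑-*ˡ (suc n) c F = trans (cong (_+ c * F n) (∑-*ˡ n c F)) (sym (*-distribˡ-+ c (∑< n F) (F n)))

  ∑-+ : ∀ n (F G : ℕ → ℕ) → ∑[ i < n ] (F i + G i) ≡ ∑< n F + ∑< n G
  ∑-+ zero    F G = refl
  ∑-+ (suc n) F G = trans (cong (_+ (F n + G n)) (∑-+ n F G)) (interchange (∑< n F) (∑< n G) (F n) (G n))
    where
    interchange : ∀ a b c d → a + b + (c + d) ≡ a + c + (b + d)
    interchange = solve-∀

  ∑-split : ∀ a b (F : ℕ → ℕ) → ∑< (a + b) F ≡ ∑< a F + ∑[ i < b ] F (a + i)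
  ∑-split a zero    F = trans (cong (λ n → ∑< n F) (+-identityʳ a)) (sym (+-identityʳ _))
  ∑-split a (suc b) F = begin
    ∑< (a + suc b) F                                   ≡⟨ cong (λ n → ∑< n F) (+-suc a b) ⟩
    ∑< (a + b) F + F (a + b)                           ≡⟨ cong (_+ F (a + b)) (∑-split a b F) ⟩
    ∑< a F + ∑[ i < b ] F (a + i) + F (a + b)          ≡⟨ +-assoc (∑< a F) _ _ ⟩
    ∑< a F + (∑[ i < b ] F (a + i) + F (a + b))        ∎
    where open ≡-Reasoning

  ∑-mono-range : ∀ {n n′} (F : ℕ → ℕ) → n ≤ n′ → ∑< n F ≤ ∑< n′ F
  ∑-mono-range {n} {n′} F n≤n′ = begin
    ∑< n F                                  ≤⟨ m≤m+n (∑< n F) _ ⟩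
    ∑< n F + ∑[ i < n′ ∸ n ] F (n + i)      ≡⟨ ∑-split n (n′ ∸ n) F ⟨
    ∑< (n + (n′ ∸ n)) F                     ≡⟨ cong (λ m → ∑< m F) (m+[n∸m]≡n n≤n′) ⟩
    ∑< n′ F                                 ∎
    where open ≤-Reasoning

  ∑-shift : ∀ n (F : ℕ → ℕ) → ∑< (suc n) F ≡ F 0 + ∑[ i < n ] F (suc i)
  ∑-shift n F = ∑-split 1 n F

  ∑-comm : ∀ a b (F : ℕ → ℕ → ℕ) → ∑[ i < a ] ∑[ j < b ] F i j ≡ ∑[ j < b ] ∑[ i < a ] F i j
  ∑-comm zero    b F = sym (trans (∑-const b 0) (*-zeroʳ b))
  ∑-comm (suc a) b F = trans (cong (_+ ∑[ j < b ] F a j) (∑-comm a b F))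
                             (sym (∑-+ b (λ j → ∑[ i < a ] F i j) (F a)))

  ∑-blocks : ∀ T q (F : ℕ → ℕ) → ∑< (T * q) F ≡ ∑[ t < T ] ∑[ c < q ] F (t * q + c)
  ∑-blocks zero    q F = refl
  ∑-blocks (suc T) q F = begin
    ∑< (q + T * q) F                                            ≡⟨ ∑-split q (T * q) F ⟩
    ∑< q F + ∑< (T * q) (λ i → F (q + i))                       ≡⟨ cong (∑< q F +_) (∑-blocks T q (λ i → F (q + i))) ⟩
    ∑< q F + ∑[ t < T ] ∑[ c < q ] F (q + (t * q + c))          ≡⟨ cong (∑< q F +_) (∑-cong T λ t _ → ∑-cong q λ c _ →
                                                                     cong F (sym (+-assoc q (t * q) c))) ⟩
    ∑< q F + ∑[ t < T ] ∑[ c < q ] F (suc t * q + c)            ≡⟨ ∑-shift T (λ t → ∑[ c < q ] F (t * q + c)) ⟨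
    ∑[ t < suc T ] ∑[ c < q ] F (t * q + c)                     ∎
    where open ≡-Reasoning

module Polynomials where

  open import Data.Nat as ℕ using (ℕ; zero; suc; pred)
  open import Data.Integer as ℤ using (ℤ; _+_; _*_; _-_; 0ℤ; 1ℤ)
  import Data.Integer.Properties as ℤP
  import Data.Nat.Properties as ℕP
  open import Data.Integer.Divisibility.Signed
    using (_∣_; divides; ∣-refl; ∣-trans; ∣m∣n⇒∣m-n; ∣n⇒∣m*n; ∣m⇒∣m*n; *-monoʳ-∣; *-monoˡ-∣)
  open import Data.Integer.Tactic.RingSolver using (solve-∀)
  open import Data.List using (List; []; _∷_; length; map)
  open import Data.List.Relation.Unary.All using (All; []; _∷_)
  import Data.List.Relation.Unary.All as All
  import Data.List.Relation.Unary.All.Properties as All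
  open import Data.Product using (Σ; _×_; _,_)
  open import Data.Sum using (_⊎_; inj₁; inj₂)
  open import Relation.Nullary using (yes; no)
  open import Relation.Binary.PropositionalEquality

  coeff : ℕ → Poly → ℤ
  coeff _       []       = 0ℤ
  coeff zero    (a ∷ _)  = a
  coeff (suc i) (_ ∷ as) = coeff i as

  degree : (f : Poly) → (∀ z → eval f z ≡ 0ℤ) ⊎
           Σ ℕ λ d → Σ Poly λ g → length g ℕ.≤ suc d × coeff d g ≢ 0ℤ × (∀ z → eval g z ≡ eval f z)
  degree [] = inj₁ (λ _ → refl)
  degree (a ∷ as) with degree as
  ... | inj₂ (d , g , len , lead , same) =
    inj₂ (suc d , a ∷ g , ℕ.s≤s len , lead , λ z → cong (λ t → a + z * t) (same z))
  ... | inj₁ zero-as with a ℤP.≟ 0ℤ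
  ...   | yes refl = inj₁ λ z → trans (cong (λ t → 0ℤ + z * t) (zero-as z)) (trans (ℤP.+-identityˡ (z * 0ℤ)) (ℤP.*-zeroʳ z))
  ...   | no a≢0   = inj₂ (0 , a ∷ [] , ℕ.s≤s ℕ.z≤n , a≢0 , λ z → cong (λ t → a + z * t) (sym (zero-as z)))

  prodUpTo-cong : ∀ {f g} → (∀ z → eval g z ≡ eval f z) → ∀ n → prodUpTo g n ≡ prodUpTo f n
  prodUpTo-cong g≡f zero    = refl
  prodUpTo-cong g≡f (suc n) = cong₂ _*_ (prodUpTo-cong g≡f n) (g≡f (ℤ.+ n))

  quot : ℤ → Poly → Poly
  quot c []           = []
  quot c (a ∷ [])     = []
  quot c (a ∷ b ∷ bs) = eval (b ∷ bs) c ∷ quot c (b ∷ bs)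

  factor-theorem : ∀ c g z → eval g z ≡ eval g c + (z - c) * eval (quot c g) z
  factor-theorem c []           z = identity c z
    where identity : ∀ c z → 0ℤ ≡ 0ℤ + (z - c) * 0ℤ
          identity = solve-∀
  factor-theorem c (a ∷ [])     z = identity a c z
    where identity : ∀ a c z → a + z * 0ℤ ≡ (a + c * 0ℤ) + (z - c) * 0ℤ
          identity = solve-∀
  factor-theorem c (a ∷ b ∷ bs) z =
    trans (cong (λ t → a + z * t) (factor-theorem c (b ∷ bs) z))
          (identity a (eval (b ∷ bs) c) (eval (quot c (b ∷ bs)) z) c z)
    where identity : ∀ a G H c z → a + z * (G + (z - c) * H) ≡ (a + c * G) + (z - c) * (G + z * H)
          identity = solve-∀

  length-quot : ∀ c g → length (quot c g) ≡ pred (length g)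
  length-quot c []           = refl
  length-quot c (a ∷ [])     = refl
  length-quot c (a ∷ b ∷ bs) = cong suc (length-quot c (b ∷ bs))

  coeff-quot : ∀ c d g → length g ℕ.≤ suc (suc d) → coeff d (quot c g) ≡ coeff (suc d) g
  coeff-quot c d       []               _ = refl
  coeff-quot c d       (a ∷ [])         _ = refl
  coeff-quot c zero    (a ∷ b ∷ [])     _ = trans (cong (b +_) (ℤP.*-zeroʳ c)) (ℤP.+-identityʳ b)
  coeff-quot c zero    (a ∷ b ∷ _ ∷ _)  (ℕ.s≤s (ℕ.s≤s ()))
  coeff-quot c (suc d) (a ∷ b ∷ bs)     (ℕ.s≤s len) = coeff-quot c d (b ∷ bs) len

  product : List ℤ → ℤ
  product []       = 1ℤ
  product (x ∷ xs) = x * product xs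

  ∣-product : ∀ xs → All (_∣ product xs) xs
  ∣-product []       = []
  ∣-product (x ∷ xs) = ∣m⇒∣m*n (product xs) ∣-refl ∷ All.map (∣n⇒∣m*n x) (∣-product xs)

  vandermonde : List ℤ → ℤ
  vandermonde []        = 1ℤ
  vandermonde (k₀ ∷ ks) = product (map (_- k₀) ks) * vandermonde ks

  -- Induct on the points, replacing g by
  -- its quotient on division by z - k₀ and c by c · ∏_{i>0} (k_i - k₀).
  vandermonde-∣ : ∀ M c k₀ ks g → length g ℕ.≤ suc (length ks) →
                  All (λ k → M ∣ c * eval g k) (k₀ ∷ ks) →
                  M ∣ c * coeff (length ks) g * vandermonde (k₀ ∷ ks)
  vandermonde-∣ M c k₀ [] []           _ _ = subst (M ∣_) (identity c) (divides 0ℤ refl)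
    where identity : ∀ c → 0ℤ * M ≡ c * 0ℤ * 1ℤ
          identity c = trans (ℤP.*-zeroˡ M) (sym (trans (ℤP.*-identityʳ (c * 0ℤ)) (ℤP.*-zeroʳ c)))
  vandermonde-∣ M c k₀ [] (a ∷ [])     _ (M∣gk₀ ∷ []) = subst (M ∣_) (identity c a k₀) M∣gk₀
    where identity : ∀ c a k₀ → c * (a + k₀ * 0ℤ) ≡ c * a * 1ℤ
          identity = solve-∀
  vandermonde-∣ M c k₀ [] (a ∷ _ ∷ _)  (ℕ.s≤s ()) _
  vandermonde-∣ M c k₀ (k₁ ∷ ks) g len (M∣gk₀ ∷ M∣gks) = subst (M ∣_) rearrange
    (vandermonde-∣ M (c * P) k₁ ks H len-H (All.zipWith M∣cPH (∣P , M∣gks)))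
    where
    P : ℤ
    P = product (map (_- k₀) (k₁ ∷ ks))
    H : Poly
    H = quot k₀ g
    ∣P : All (λ k → (k - k₀) ∣ P) (k₁ ∷ ks)
    ∣P = All.map⁻ (∣-product (map (_- k₀) (k₁ ∷ ks)))
    len-H : length H ℕ.≤ suc (length ks)
    len-H = subst (ℕ._≤ suc (length ks)) (sym (length-quot k₀ g)) (ℕP.pred-mono-≤ len)
    -- M ∣ c·g(k) - c·g(k₀) = c·(k - k₀)·H(k), and (k - k₀) ∣ P.
    M∣cPH : ∀ {k} → (k - k₀) ∣ P × M ∣ c * eval g k → M ∣ c * P * eval H k
    M∣cPH {k} (k-k₀∣P , M∣gk) = ∣-trans M∣c[k-k₀]H (subst ((c * ((k - k₀) * eval H k)) ∣_)
      (sym (ℤP.*-assoc c P (eval H k))) (*-monoʳ-∣ c (*-monoˡ-∣ (eval H k) k-k₀∣P)))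
      where
      difference : c * eval g k - c * eval g k₀ ≡ c * ((k - k₀) * eval H k)
      difference rewrite factor-theorem k₀ g k = identity c (eval g k₀) (k - k₀) (eval H k)
        where identity : ∀ c G x y → c * (G + x * y) - c * G ≡ c * (x * y)
              identity = solve-∀
      M∣c[k-k₀]H : M ∣ c * ((k - k₀) * eval H k)
      M∣c[k-k₀]H = subst (M ∣_) difference (∣m∣n⇒∣m-n M∣gk M∣gk₀)
    rearrange : c * P * coeff (length ks) H * vandermonde (k₁ ∷ ks) ≡
                c * coeff (suc (length ks)) g * vandermonde (k₀ ∷ k₁ ∷ ks)
    rearrange rewrite coeff-quot k₀ (length ks) g len =
      identity c P (coeff (suc (length ks)) g) (vandermonde (k₁ ∷ ks))
      where identity : ∀ c P a V → c * P * a * V ≡ c * a * (P * V)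
            identity = solve-∀

module PolynomialSize where

  open import Data.Nat using (suc; _+_; _*_; _^_; _<_; _>_; z≤n; s≤s; >-nonZero)
  open import Data.Nat.Properties
  open import Data.Integer as ℤ using (∣_∣)
  import Data.Integer.Properties as ℤP
  open import Data.List using ([]; _∷_)
  open import Data.List.Relation.Unary.All using (All; []; _∷_)
  import Data.List.Relation.Unary.All as All
  open import Relation.Binary.PropositionalEquality
  open import Data.Nat.Tactic.RingSolver using (solve-∀)

  norm : Poly → ℕ
  norm []       = 0
  norm (a ∷ as) = ∣ a ∣ + norm as

  coeff≤norm : ∀ h → All (λ a → ∣ a ∣ ≤ norm h) h
  coeff≤norm []       = []
  coeff≤norm (a ∷ as) = m≤m+n ∣ a ∣ (norm as) ∷ All.map (λ le → ≤-trans le (m≤n+m (norm as) ∣ a ∣)) (coeff≤norm as)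

  eval-bound : ∀ h R → All (λ a → ∣ a ∣ < R) h → ∀ k → ∣ eval h (ℤ.+ k) ∣ < (R * suc k) ^ length h
  eval-bound []       R _           k = s≤s z≤n
  eval-bound (a ∷ as) R (a<R ∷ as<R) k = begin-strict
    ∣ a ℤ.+ ℤ.+ k ℤ.* e ∣        ≤⟨ ℤP.∣i+j∣≤∣i∣+∣j∣ a (ℤ.+ k ℤ.* e) ⟩
    ∣ a ∣ + ∣ ℤ.+ k ℤ.* e ∣      ≡⟨ cong (_+_ ∣ a ∣) (ℤP.abs-* (ℤ.+ k) e) ⟩
    ∣ a ∣ + k * ∣ e ∣            <⟨ +-monoˡ-< (k * ∣ e ∣) a<R ⟩
    R + k * ∣ e ∣                ≤⟨ +-mono-≤ (m≤m*n R (Y ^ l) ⦃ >-nonZero Y^l>0 ⦄)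
                                             (*-monoʳ-≤ k (≤-trans (<⇒≤ ih) (m≤n*m (Y ^ l) R ⦃ >-nonZero R>0 ⦄))) ⟩
    R * Y ^ l + k * (R * Y ^ l)  ≡⟨ factor R k (Y ^ l) ⟩
    (R * suc k) * Y ^ l          ∎
    where
    open ≤-Reasoning
    e : ℤ.ℤ
    e = eval as (ℤ.+ k)
    Y l : ℕ
    Y = R * suc k
    l = length as
    ih : ∣ e ∣ < Y ^ l
    ih = eval-bound as R as<R k
    Y^l>0 : Y ^ l > 0
    Y^l>0 = ≤-<-trans z≤n ih
    R>0 : R > 0
    R>0 = ≤-<-trans z≤n a<R
    factor : ∀ R k P → R * P + k * (R * P) ≡ (R * suc k) * P
    factor = solve-∀

module ResidueClasses where

  open FiniteSums
  open import Data.Nat using (ℕ; zero; suc; _+_; _*_; _∸_; _≤_; _<_; z≤n; NonZero; _%_)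
  open import Data.Nat.Properties
  open import Data.Nat.Divisibility using (_∣_; n∣m*n)
  open import Data.Nat.DivMod using (%-remove-+ˡ; %-remove-+ʳ; m<n⇒m%n≡m)
  open import Data.Integer as ℤ using (+_; ∣_∣)
  import Data.Integer.Properties as ℤP
  open import Data.List using (List; []; _∷_; length)
  open import Data.List.Relation.Unary.All using (All; []; _∷_)
  import Data.List.Relation.Unary.All as All
  open import Data.List.Relation.Unary.AllPairs using (AllPairs; []; _∷_)
  open import Data.Product using (Σ; ∃; _×_; _,_)
  open import Data.Sum using (inj₁; inj₂)
  open import Relation.Nullary using (Dec; yes; no; contradiction)
  open import Relation.Unary using (Decidable)
  open import Relation.Binary.PropositionalEquality

  ∣a-b∣≡a∸b : ∀ {a b} → b ≤ a → ∣ + a ℤ.- + b ∣ ≡ a ∸ b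
  ∣a-b∣≡a∸b {a} {b} b≤a = cong ∣_∣ (trans (ℤP.m-n≡m⊖n a b) (ℤP.⊖-≥ b≤a))

  ∸-∣⇒≡-mod : ∀ q .{{_ : NonZero q}} {a b} → b ≤ a → q ∣ a ∸ b → a % q ≡ b % q
  ∸-∣⇒≡-mod q {a} {b} b≤a q∣a∸b = begin
    a % q               ≡⟨ cong (_% q) (m+[n∸m]≡n b≤a) ⟨
    (b + (a ∸ b)) % q   ≡⟨ %-remove-+ʳ b q∣a∸b ⟩
    b % q               ∎
    where open ≡-Reasoning

  ∣-distance⇒≡-mod : ∀ q .{{_ : NonZero q}} a b → q ∣ ∣ + a ℤ.- + b ∣ → a % q ≡ b % q
  ∣-distance⇒≡-mod q a b q∣a-b with ≤-total b a
  ... | inj₁ b≤a = ∸-∣⇒≡-mod q b≤a (subst (q ∣_) (∣a-b∣≡a∸b b≤a) q∣a-b)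
  ... | inj₂ a≤b = sym (∸-∣⇒≡-mod q a≤b (subst (q ∣_) ∣a-b∣≡b∸a q∣a-b))
    where
    ∣a-b∣≡b∸a : ∣ + a ℤ.- + b ∣ ≡ b ∸ a
    ∣a-b∣≡b∸a = trans (ℤP.∣i-j∣≡∣j-i∣ (+ a) (+ b)) (∣a-b∣≡a∸b a≤b)

  block-residue : ∀ q .{{_ : NonZero q}} t {c} → c < q → (t * q + c) % q ≡ c
  block-residue q t {c} c<q = trans (%-remove-+ˡ c (n∣m*n t)) (m<n⇒m%n≡m c<q)

  module ByClasses {P : ℕ → Set} (P? : Decidable P) (q T : ℕ) .{{_ : NonZero q}} where

    Hit : ℕ → Set
    Hit c = ∃ λ t → t < T × P (t * q + c)

    hit? : ∀ c → Dec (Hit c)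
    hit? c = anyUpTo? (λ t → P? (t * q + c)) T

    -- Each class contributes at most T points, and only if it is hit.
    count-by-classes : ∑[ k < T * q ] 𝟙 (P? k) ≤ T * ∑[ c < q ] 𝟙 (hit? c)
    count-by-classes = begin
      ∑[ k < T * q ] 𝟙 (P? k)                       ≡⟨ ∑-blocks T q (λ k → 𝟙 (P? k)) ⟩
      ∑[ t < T ] ∑[ c < q ] 𝟙 (P? (t * q + c))      ≡⟨ ∑-comm T q (λ t c → 𝟙 (P? (t * q + c))) ⟩
      ∑[ c < q ] ∑[ t < T ] 𝟙 (P? (t * q + c))      ≤⟨ ∑-mono q (λ c _ → per-class c (hit? c)) ⟩
      ∑[ c < q ] (T * 𝟙 (hit? c))                   ≡⟨ ∑-*ˡ q T (λ c → 𝟙 (hit? c)) ⟩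
      T * ∑[ c < q ] 𝟙 (hit? c)                     ∎
      where
      open ≤-Reasoning
      per-class : ∀ c (h : Dec (Hit c)) → ∑[ t < T ] 𝟙 (P? (t * q + c)) ≤ T * 𝟙 h
      per-class c (yes _)  = ∑-≤-const T 1 _ (λ t _ → 𝟙≤1 (P? (t * q + c)))
      per-class c (no ¬hit) = ∑-≤-const T 0 _ miss
        where
        miss : ∀ t → t < T → 𝟙 (P? (t * q + c)) ≤ 0
        miss t t<T with P? (t * q + c)
        ... | yes Pk = contradiction (t , t<T , Pk) ¬hit
        ... | no  _  = z≤n

    spread : ∀ r L → r ≤ q → L ≤ ∑[ c < r ] 𝟙 (hit? c) →
             Σ (List ℕ) λ ks → length ks ≡ L × All P ks ×
               All (λ k → k % q < r) ks × AllPairs (λ a b → a % q ≢ b % q) ks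
    spread zero    zero    _   _ = [] , refl , [] , [] , []
    spread (suc r) L       r<q L≤hits with hit? r
    spread (suc r) zero    r<q L≤hits | _ = [] , refl , [] , [] , []
    spread (suc r) (suc L) r<q L≤hits | yes (t , _ , Pk)
      with spread r L (<⇒≤ r<q) (≤-pred (subst (suc L ≤_) (+-comm _ 1) L≤hits))
    ... | ks , refl , Pks , ks<r , distinct =
      k ∷ ks , refl , Pk ∷ Pks , ≤-reflexive (cong suc k%q≡r) ∷ All.map m<n⇒m<1+n ks<r , new-class ∷ distinct
      where
      k : ℕ
      k = t * q + r
      k%q≡r : k % q ≡ r
      k%q≡r = block-residue q t r<q
      new-class : All (λ k′ → k % q ≢ k′ % q) ks
      new-class = All.map (λ k′%q<r k%q≡k′%q → <-irrefl (trans (sym k%q≡k′%q) k%q≡r) k′%q<r) ks<r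
    spread (suc r) L       r<q L≤hits | no _
      with spread r L (<⇒≤ r<q) (subst (L ≤_) (+-identityʳ _) L≤hits)
    ... | ks , len , Pks , ks<r , distinct = ks , len , Pks , All.map m<n⇒m<1+n ks<r , distinct

module Powers (p : ℕ) .{{_ : NonTrivial p}} where

  open FiniteSums
  open import Data.Nat as ℕ using (zero; suc; _+_; _*_; _∸_; _^_; _≤_; _<_; z≤n; s≤s; NonZero)
  open import Data.Nat.Properties
  open import Data.Nat.Divisibility using (_∣_; m∣m*n)
  open import Data.Nat.DivMod using (_/_; _%_; m≡m%n+[m/n]*n; m%n<n; m/n/o≡m/[n*o]; /-congʳ; m/n*n≤m)
  open import Relation.Nullary using (yes; no; contradiction)
  open import Relation.Binary.PropositionalEquality

  instance
    p≢0 : NonZero p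
    p≢0 = ℕ.nonTrivial⇒nonZero p

  -- Passed explicitly: instance search cannot recover m from p ^ m.
  p^≢0 : ∀ m → NonZero (p ^ m)
  p^≢0 m = m^n≢0 p m

  ^-∣-^ : ∀ {m n} → m ≤ n → p ^ m ∣ p ^ n
  ^-∣-^ {m} {n} m≤n = subst (p ^ m ∣_) p^n≡p^m*p^[n∸m] (m∣m*n (p ^ (n ∸ m)))
    where
    p^n≡p^m*p^[n∸m] : p ^ m * p ^ (n ∸ m) ≡ p ^ n
    p^n≡p^m*p^[n∸m] = trans (sym (^-distribˡ-+-* p m (n ∸ m))) (cong (p ^_) (m+[n∸m]≡n m≤n))

  n<p^n : ∀ n → n < p ^ n
  n<p^n zero    = s≤s z≤n
  n<p^n (suc n) = begin-strict
    suc n           ≤⟨ n<p^n n ⟩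
    p ^ n           <⟨ m<m*n (p ^ n) p ⦃ p^≢0 n ⦄ (ℕ.nonTrivial⇒n>1 p) ⟩
    p ^ n * p       ≡⟨ *-comm (p ^ n) p ⟩
    p ^ suc n       ∎
    where open ≤-Reasoning

  ^-reflect-< : ∀ {a b} → p ^ a < p ^ b → a < b
  ^-reflect-< {a} {b} p^a<p^b with a <? b
  ... | yes a<b = a<b
  ... | no  a≮b = contradiction (^-monoʳ-≤ p (≮⇒≥ a≮b)) (<⇒≱ p^a<p^b)

  _/p^_ : ℕ → ℕ → ℕ
  x /p^ m = _/_ x (p ^ m) ⦃ p^≢0 m ⦄

  <[1+/p^]*p^ : ∀ x m → x < suc (x /p^ m) * p ^ m
  <[1+/p^]*p^ x m = begin-strict
    x                                    ≡⟨ m≡m%n+[m/n]*n x (p ^ m) ⦃ p^≢0 m ⦄ ⟩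
    _%_ x (p ^ m) ⦃ p^≢0 m ⦄ + x /p^ m * p ^ m
                                         <⟨ +-monoˡ-< _ (m%n<n x (p ^ m) ⦃ p^≢0 m ⦄) ⟩
    p ^ m + x /p^ m * p ^ m              ∎
    where open ≤-Reasoning

  -- Σ_{m<M} ⌊x / p^(m+1)⌋ ≤ x: the terms at least halve each time.
  ∑-/p^ : ∀ M x → ∑[ m < M ] (x /p^ suc m) ≤ x
  ∑-/p^ zero    x = z≤n
  ∑-/p^ (suc M) x = begin
    ∑[ m < suc M ] (x /p^ suc m)                    ≡⟨ ∑-shift M (λ m → x /p^ suc m) ⟩
    x /p^ 1 + ∑[ m < M ] (x /p^ suc (suc m))        ≡⟨ cong₂ _+_ x/p^1≡x/p (∑-cong M λ m _ → x/p^m+2≡[x/p]/p^m+1 m) ⟩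
    x / p + ∑[ m < M ] ((x / p) /p^ suc m)          ≤⟨ +-monoʳ-≤ (x / p) (∑-/p^ M (x / p)) ⟩
    x / p + x / p                                   ≡⟨ cong (_+_ (x / p)) (+-identityʳ (x / p)) ⟨
    2 * (x / p)                                     ≤⟨ *-monoˡ-≤ (x / p) (ℕ.nonTrivial⇒n>1 p) ⟩
    p * (x / p)                                     ≡⟨ *-comm p (x / p) ⟩
    (x / p) * p                                     ≤⟨ m/n*n≤m x p ⟩
    x                                               ∎
    where
    open ≤-Reasoning
    x/p^1≡x/p : x /p^ 1 ≡ x / p
    x/p^1≡x/p = /-congʳ ⦃ p^≢0 1 ⦄ (*-identityʳ p)
    x/p^m+2≡[x/p]/p^m+1 : ∀ m → x /p^ suc (suc m) ≡ (x / p) /p^ suc m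
    x/p^m+2≡[x/p]/p^m+1 m = sym (m/n/o≡m/[n*o] x p (p ^ suc m) ⦃ _ ⦄ ⦃ p^≢0 (suc m) ⦄ ⦃ p^≢0 (suc (suc m)) ⦄)

module Valuations (p : ℕ) .{{_ : NonTrivial p}} (p-prime : Prime p) where

  open Polynomials
  open FiniteSums
  open Powers p
  open import Data.Nat using (zero; suc; _+_; _*_; _^_; _≤_; _<_; s≤s; nonTrivial⇒≢1)
  open import Data.Nat.Properties
  open import Data.Nat.Divisibility
  open import Data.Nat.Primality using (euclidsLemma)
  open import Data.Integer as ℤ using (ℤ; ∣_∣; +_; 0ℤ)
  import Data.Integer.Properties as ℤP
  import Data.Integer.Divisibility.Signed as Signed
  open import Data.List using (List; []; _∷_; length; map)
  open import Data.List.Relation.Unary.All using (All; []; _∷_)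
  import Data.List.Relation.Unary.All as All
  import Data.List.Relation.Unary.All.Properties as All
  open import Data.List.Relation.Unary.AllPairs using (AllPairs; []; _∷_)
  import Data.List.Properties as List
  open import Data.Product using (Σ; _×_; _,_)
  open import Function using (_∘_)
  open import Data.Sum using ([_,_]′)
  open import Relation.Nullary using (¬_; yes; no; contradiction)
  open import Relation.Binary.PropositionalEquality
  open import Data.Nat.Tactic.RingSolver using (solve-∀)

  -- "v_p(x) ≤ s", stated without the valuation itself: p^(s+1) does not divide x.
  -- (A record rather than a definition, so that s and x can be inferred.)
  record Val≤ (s x : ℕ) : Set where
    constructor val≤
    field p^s+1∤x : ¬ (p ^ suc s ∣ x)

  Val≤⇒≤ : ∀ {s v x} → Val≤ s x → p ^ v ∣ x → v ≤ s
  Val≤⇒≤ {s} {v} (val≤ p^s+1∤x) p^v∣x with v ≤? s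
  ... | yes v≤s = v≤s
  ... | no  v≰s = contradiction (∣-trans (^-∣-^ (≰⇒> v≰s)) p^v∣x) p^s+1∤x

  exact-valuation : ∀ s x → Val≤ s x → Σ ℕ λ w → p ^ w ∣ x × Val≤ w x
  exact-valuation zero    x v≤0 = 0 , 1∣ x , v≤0
  exact-valuation (suc s) x v≤s+1 with p ^ suc s ∣? x
  ... | yes p^s+1∣x = suc s , p^s+1∣x , v≤s+1
  ... | no  p^s+1∤x = exact-valuation s x (val≤ p^s+1∤x)

  Val≤-1 : Val≤ 0 1
  Val≤-1 = val≤ λ p∣1 → contradiction (∣1⇒≡1 (subst (_∣ 1) (*-identityʳ p) p∣1)) (nonTrivial⇒≢1 {p})

  -- A nonzero x satisfies v_p(x) ≤ x, since x < p^(x+1).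
  Val≤-self : ∀ {x} → x ≢ 0 → Val≤ x x
  Val≤-self {zero}  x≢0 = contradiction refl x≢0
  Val≤-self {suc x} _   = val≤ (>⇒∤ (<-trans (n<1+n (suc x)) (n<p^n (suc (suc x)))))

  cofactor-coprime : ∀ {w x x′} → x ≡ x′ * p ^ w → Val≤ w x → ¬ (p ∣ x′)
  cofactor-coprime {w} x≡x′p^w (val≤ p^w+1∤x) p∣x′ =
    p^w+1∤x (subst (p ^ suc w ∣_) (sym x≡x′p^w) (*-monoˡ-∣ (p ^ w) p∣x′))

  -- The valuation is subadditive on products (in fact additive, since p is prime):
  -- with x = x′·p^w, y = y′·p^u exactly, p^(w+u+1) ∣ xy would force p ∣ x′y′.
  Val≤-* : ∀ {s t x y} → Val≤ s x → Val≤ t y → Val≤ (s + t) (x * y)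
  Val≤-* {s} {t} {x} {y} v[x]≤s v[y]≤t =
    val≤ (p∤ (exact-valuation s x v[x]≤s) (exact-valuation t y v[y]≤t))
    where
    p∤ : (Σ ℕ λ w → p ^ w ∣ x × Val≤ w x) → (Σ ℕ λ u → p ^ u ∣ y × Val≤ u y) → ¬ (p ^ suc (s + t) ∣ x * y)
    p∤ (w , p^w∣x@(divides x′ x≡x′p^w) , v[x]≤w) (u , p^u∣y@(divides y′ y≡y′p^u) , v[y]≤u) p^s+t+1∣xy =
      [ cofactor-coprime {w} x≡x′p^w v[x]≤w , cofactor-coprime {u} y≡y′p^u v[y]≤u ]′
        (euclidsLemma x′ y′ p-prime (*-cancelˡ-∣ (p ^ (w + u)) ⦃ p^≢0 (w + u) ⦄ p^[w+u]p∣p^[w+u]x′y′))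
      where
      xy≡p^[w+u]x′y′ : x * y ≡ p ^ (w + u) * (x′ * y′)
      xy≡p^[w+u]x′y′ = begin
        x * y                             ≡⟨ cong₂ _*_ x≡x′p^w y≡y′p^u ⟩
        (x′ * p ^ w) * (y′ * p ^ u)       ≡⟨ regroup x′ y′ (p ^ w) (p ^ u) ⟩
        (p ^ w * p ^ u) * (x′ * y′)       ≡⟨ cong (_* (x′ * y′)) (^-distribˡ-+-* p w u) ⟨
        p ^ (w + u) * (x′ * y′)           ∎
        where
        open ≡-Reasoning
        regroup : ∀ a b c d → (a * c) * (b * d) ≡ (c * d) * (a * b)
        regroup = solve-∀
      w+u≤s+t : w + u ≤ s + t
      w+u≤s+t = +-mono-≤ (Val≤⇒≤ {v = w} v[x]≤s p^w∣x) (Val≤⇒≤ {v = u} v[y]≤t p^u∣y)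
      p^[w+u]p∣p^[w+u]x′y′ : p ^ (w + u) * p ∣ p ^ (w + u) * (x′ * y′)
      p^[w+u]p∣p^[w+u]x′y′ = subst₂ _∣_ (*-comm p (p ^ (w + u))) xy≡p^[w+u]x′y′
        (∣-trans (^-∣-^ (s≤s w+u≤s+t)) p^s+t+1∣xy)

  Val≤-product : ∀ {m} xs → All (λ x → Val≤ m ∣ x ∣) xs → Val≤ (length xs * m) ∣ product xs ∣
  Val≤-product []       []       = Val≤-1
  Val≤-product (x ∷ xs) (v ∷ vs) rewrite ℤP.abs-* x (product xs) = Val≤-* v (Val≤-product xs vs)

  pairs : ℕ → ℕ
  pairs zero    = 0
  pairs (suc n) = n + pairs n

  Separated : ℕ → List ℤ → Set
  Separated m = AllPairs (λ a b → Val≤ m ∣ b ℤ.- a ∣)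

  Val≤-vandermonde : ∀ {m} ks → Separated m ks → Val≤ (pairs (length ks) * m) ∣ vandermonde ks ∣
  Val≤-vandermonde         []        []            = Val≤-1
  Val≤-vandermonde {m} (k₀ ∷ ks) (sep₀ ∷ sep) =
    subst₂ Val≤ exponent (sym (ℤP.abs-* (product differences) (vandermonde ks)))
      (Val≤-* (Val≤-product differences (All.map⁺ sep₀)) (Val≤-vandermonde ks sep))
    where
    differences : List ℤ
    differences = map (ℤ._- k₀) ks
    exponent : length differences * m + pairs (length ks) * m ≡ pairs (suc (length ks)) * m
    exponent = trans (cong (λ l → l * m + pairs (length ks) * m) (List.length-map (ℤ._- k₀) ks))
                     (sym (*-distribʳ-+ m (length ks) (pairs (length ks))))

  -- Let g have degree ≤ d with z^d-coefficient a ≠ 0.  If p^j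
  -- divides g at d + 1 points whose pairwise differences have valuation ≤ m, then
  -- j ≤ |a| + pairs(d + 1)·m: interpolation gives p^j ∣ a·V, while v_p(a) ≤ |a|
  -- and v_p(V) ≤ pairs(d + 1)·m.
  divisible-at-separated-points :
    ∀ {m j d} g ks → length g ≤ suc d → coeff d g ≢ 0ℤ → length ks ≡ suc d →
    Separated m ks → All (λ k → p ^ j ∣ ∣ eval g k ∣) ks → j ≤ ∣ coeff d g ∣ + pairs (suc d) * m
  divisible-at-separated-points {m} {j} g (k₀ ∷ ks) len a≢0 refl sep p^j∣g =
    Val≤⇒≤ (Val≤-* (Val≤-self (a≢0 ∘ ℤP.∣i∣≡0⇒i≡0)) (Val≤-vandermonde (k₀ ∷ ks) sep)) p^j∣aV
    where
    a : ℤ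
    a = coeff (length ks) g
    p^j∣aV : p ^ j ∣ ∣ a ∣ * ∣ vandermonde (k₀ ∷ ks) ∣
    p^j∣aV = subst (p ^ j ∣_) (trans (cong (λ c → ∣ c ℤ.* vandermonde (k₀ ∷ ks) ∣) (ℤP.*-identityˡ a))
                                    (ℤP.abs-* a (vandermonde (k₀ ∷ ks))))
      (Signed.∣⇒∣ᵤ (vandermonde-∣ (+ p ^ j) (ℤ.+ 1) k₀ ks g len
        (All.map (λ p^j∣gk → subst (+ p ^ j Signed.∣_) (sym (ℤP.*-identityˡ _)) (Signed.∣ᵤ⇒∣ p^j∣gk)) p^j∣g)))

  -- v_p(x) ≥ w is witnessed by the w layers p^1, …, p^w dividing x, so w is at most
  -- the number of layers i < J with p^(i+1) ∣ x, for any J ≥ w.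
  ≤-∑-layers : ∀ {w x} J → p ^ w ∣ x → w ≤ J → w ≤ ∑[ i < J ] 𝟙 (p ^ suc i ∣? x)
  ≤-∑-layers {w} {x} J p^w∣x w≤J = begin
    w                                   ≡⟨ trans (∑-const w 1) (*-identityʳ w) ⟨
    ∑[ i < w ] 1                        ≤⟨ ∑-mono w layer ⟩
    ∑[ i < w ] 𝟙 (p ^ suc i ∣? x)       ≤⟨ ∑-mono-range (λ i → 𝟙 (p ^ suc i ∣? x)) w≤J ⟩
    ∑[ i < J ] 𝟙 (p ^ suc i ∣? x)       ∎
    where
    open ≤-Reasoning
    layer : ∀ i → i < w → 1 ≤ 𝟙 (p ^ suc i ∣? x)
    layer i i<w with p ^ suc i ∣? x
    ... | yes _      = ≤-refl
    ... | no  p^i+1∤x = contradiction (∣-trans (^-∣-^ i<w) p^w∣x) p^i+1∤x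

module Layers (p : ℕ) .{{_ : NonTrivial p}} (p-prime : Prime p)
              (g : Poly) (d : ℕ) (deg-g : length g ≤ suc d) (lead≢0 : Polynomials.coeff d g ≢ 0ℤ) where

  open FiniteSums
  open Polynomials
  open ResidueClasses
  open Powers p
  open Valuations p p-prime
  open PolynomialSize
  open import Data.Nat as ℕ using (zero; _+_; _*_; _^_; _<_; s≤s)
  open import Data.Nat.Properties
  open import Data.Nat.Divisibility using (_∣_; _∣?_; ∣⇒≤)
  open import Data.Integer as ℤ using (ℤ; ∣_∣)
  import Data.Integer.Properties as ℤP
  open import Data.List using (map)
  import Data.List.Properties as List
  import Data.List.Relation.Unary.All as All
  import Data.List.Relation.Unary.All.Properties as All
  import Data.List.Relation.Unary.AllPairs as AllPairs
  import Data.List.Relation.Unary.AllPairs.Properties as AllPairs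
  open import Data.Product using (Σ; _×_; _,_; proj₁; proj₂)
  open import Relation.Nullary using (yes; no; contradiction)
  open import Relation.Binary.PropositionalEquality hiding (J)
  open import Function using (_∘_)
  open import Data.Nat.Tactic.RingSolver using (solve-∀)

  W : ℕ → ℕ
  W k = ∣ eval g (ℤ.+ k) ∣

  -- The constants of the key estimate: |lead g| and the number of pairs of d + 1 points.
  B D : ℕ
  B = ∣ coeff d g ∣
  D = pairs (suc d)

  N : ℕ → ℕ → ℕ
  N j n = ∑[ k < n ] 𝟙 (p ^ j ∣? W k)

  N≤n : ∀ j n → N j n ≤ n
  N≤n j n = subst (N j n ≤_) (*-identityʳ n) (∑-≤-const n 1 _ (λ k _ → 𝟙≤1 (p ^ j ∣? W k)))

  -- Deep layers are sparse: if j > B + D·m, the k with p^j ∣ g(k) occupy at most d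
  -- residue classes mod p^(m+1) (d + 1 of them would contradict the key estimate),
  -- so below n there are at most (⌊n / p^(m+1)⌋ + 1)·d of them.
  layer-bound : ∀ {j} m n → B + D * m < j → N j n ≤ suc (n /p^ suc m) * d
  layer-bound {j} m n j>B+Dm = begin
    N j n                                  ≤⟨ ∑-mono-range _ (<⇒≤ (<[1+/p^]*p^ n (suc m))) ⟩
    N j (T * q)                            ≤⟨ count-by-classes ⟩
    T * ∑[ c < q ] 𝟙 (hit? c)              ≤⟨ *-monoʳ-≤ T few-classes ⟩
    T * d                                  ∎
    where
    open ≤-Reasoning
    q T : ℕ
    q = p ^ suc m
    T = suc (n /p^ suc m)
    instance
      q≢0 : ℕ.NonZero q
      q≢0 = p^≢0 (suc m)
    open ByClasses (λ k → p ^ j ∣? W k) q T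
    few-classes : ∑[ c < q ] 𝟙 (hit? c) ≤ d
    few-classes with ∑[ c < q ] 𝟙 (hit? c) ≤? d
    ... | yes few = few
    ... | no many with spread q (suc d) ≤-refl (≰⇒> many)
    ...   | ks , length≡ , p^j∣g , _ , distinct = contradiction
      (divisible-at-separated-points g (map ℤ.+_ ks) deg-g lead≢0 (trans (List.length-map ℤ.+_ ks) length≡)
         (AllPairs.map⁺ (AllPairs.map separated distinct)) (All.map⁺ p^j∣g))
      (<⇒≱ j>B+Dm)
      where
      separated : ∀ {a b} → a ℕ.% q ≢ b ℕ.% q → Val≤ m ∣ ℤ.+ b ℤ.- ℤ.+ a ∣
      separated {a} {b} a≢b = val≤ λ q∣b-a → a≢b (sym (∣-distance⇒≡-mod q b a q∣b-a))

  -- Summing the layers 1, …, B + (D + 1)·M: the first B contribute at most n each; the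
  -- others fall into M blocks of D + 1 consecutive layers, block m lying above B + D·m.
  layers-sum : ∀ n M → ∑[ i < B + suc D * M ] N (suc i) n ≤ B * n + suc D * d * (M + n)
  layers-sum n M = begin
    ∑[ i < B + D′ * M ] N (suc i) n
      ≡⟨ ∑-split B (D′ * M) _ ⟩
    ∑[ i < B ] N (suc i) n + ∑[ i < D′ * M ] N (suc (B + i)) n
      ≤⟨ +-mono-≤ (∑-≤-const B n _ (λ i _ → N≤n (suc i) n)) (≤-reflexive (cong (λ l → ∑[ i < l ] N (suc (B + i)) n) (*-comm D′ M))) ⟩
    B * n + ∑[ i < M * D′ ] N (suc (B + i)) n
      ≡⟨ cong (_+_ (B * n)) (∑-blocks M D′ _) ⟩
    B * n + ∑[ m < M ] ∑[ r < D′ ] N (suc (B + (m * D′ + r))) n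
      ≤⟨ +-monoʳ-≤ (B * n) (∑-mono M λ m _ → ∑-≤-const D′ _ _ λ r _ → layer-bound m n (deep m r)) ⟩
    B * n + ∑[ m < M ] (D′ * (suc (n /p^ suc m) * d))
      ≡⟨ cong (_+_ (B * n)) (trans (∑-cong M λ m _ → regroup D′ (suc (n /p^ suc m)) d) (∑-*ˡ M (D′ * d) _)) ⟩
    B * n + D′ * d * ∑[ m < M ] suc (n /p^ suc m)
      ≤⟨ +-monoʳ-≤ (B * n) (*-monoʳ-≤ (D′ * d) quotients-sum) ⟩
    B * n + D′ * d * (M + n)
      ∎
    where
    open ≤-Reasoning
    D′ : ℕ
    D′ = suc D
    deep : ∀ m r → B + D * m < suc (B + (m * D′ + r))
    deep m r = s≤s (+-monoʳ-≤ B (≤-trans (subst (D * m ≤_) (*-comm D′ m) (*-monoˡ-≤ m (n≤1+n D)))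
                                         (m≤m+n (m * D′) r)))
    regroup : ∀ a b c → a * (b * c) ≡ a * c * b
    regroup = solve-∀
    quotients-sum : ∑[ m < M ] suc (n /p^ suc m) ≤ M + n
    quotients-sum = begin
      ∑[ m < M ] (1 + n /p^ suc m)               ≡⟨ ∑-+ M (λ _ → 1) (λ m → n /p^ suc m) ⟩
      ∑[ m < M ] 1 + ∑[ m < M ] (n /p^ suc m)    ≤⟨ +-mono-≤ (≤-reflexive (trans (∑-const M 1) (*-identityʳ M))) (∑-/p^ M n) ⟩
      M + n                                      ∎

  -- A strict bound for the coefficients of g, and the exponent K with
  -- |g(k)| < p^((k+1)·K) for all k.
  R K : ℕ
  R = suc (norm g)
  K = suc R * suc d

  value-bound : ∀ k → W k < p ^ (suc k * K)
  value-bound k = begin-strict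
    W k                            <⟨ eval-bound g R (All.map s≤s (coeff≤norm g)) k ⟩
    (R * suc k) ^ length g         ≤⟨ ^-monoʳ-≤ (R * suc k) deg-g ⟩
    (R * suc k) ^ suc d            ≤⟨ ^-monoˡ-≤ (suc d) (*-mono-≤ (<⇒≤ (n<p^n R)) (<⇒≤ (n<p^n (suc k)))) ⟩
    (p ^ R * p ^ suc k) ^ suc d    ≡⟨ cong (_^ suc d) (^-distribˡ-+-* p R (suc k)) ⟨
    (p ^ (R + suc k)) ^ suc d      ≡⟨ ^-*-assoc p (R + suc k) (suc d) ⟩
    p ^ ((R + suc k) * suc d)      ≤⟨ ^-monoʳ-≤ p exponent ⟩
    p ^ (suc k * K)                ∎
    where
    open ≤-Reasoning
    R+k+1≤[k+1][R+1] : R + suc k ≤ suc k * suc R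
    R+k+1≤[k+1][R+1] = subst (R + suc k ≤_) (sym (*-suc (suc k) R))
      (subst (_≤ suc k + suc k * R) (+-comm (suc k) R) (+-monoʳ-≤ (suc k) (m≤n*m R (suc k))))
    exponent : (R + suc k) * suc d ≤ suc k * K
    exponent = subst ((R + suc k) * suc d ≤_) (*-assoc (suc k) (suc R) (suc d)) (*-monoˡ-≤ (suc d) R+k+1≤[k+1][R+1])

  C : ℕ
  C = B + suc D * d * suc K

  C>0 : C ℕ.> 0
  C>0 = ≤-trans (n≢0⇒n>0 (lead≢0 ∘ ℤP.∣i∣≡0⇒i≡0)) (m≤m+n B _)

  module _ (g≢0 : ∀ k → W k ≢ 0) where

    -- The exact valuation of g(k); it exists because v_p(g(k)) ≤ |g(k)|.
    exact : ∀ k → Σ ℕ λ w → p ^ w ∣ W k × Val≤ w (W k)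
    exact k = exact-valuation (W k) (W k) (Val≤-self (g≢0 k))

    val : ℕ → ℕ
    val k = proj₁ (exact k)

    p^val∣W : ∀ k → p ^ val k ∣ W k
    p^val∣W k = proj₁ (proj₂ (exact k))

    Val≤-val : ∀ k → Val≤ (val k) (W k)
    Val≤-val k = proj₂ (proj₂ (exact k))

    Val≤-prodUpTo : ∀ n → Val≤ (∑< n val) ∣ prodUpTo g n ∣
    Val≤-prodUpTo zero    = Val≤-1
    Val≤-prodUpTo (suc n) rewrite ℤP.abs-* (prodUpTo g n) (eval g (ℤ.+ n)) =
      Val≤-* (Val≤-prodUpTo n) (Val≤-val n)

    -- v_p(g(k)) < (k + 1)·K, since p^(v_p(g(k))) ≤ |g(k)| < p^((k+1)·K).
    val< : ∀ k → val k < suc k * K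
    val< k = ^-reflect-< (≤-<-trans (∣⇒≤ ⦃ ℕ.≢-nonZero (g≢0 k) ⦄ (p^val∣W k)) (value-bound k))

    -- Count the valuation of the product layer by layer: only the layers up to
    -- J = B + (D + 1)·n·K can be nonempty below n.
    product-bound : ∀ n v → p ^ v ∣ ∣ prodUpTo g n ∣ → v ≤ C * n
    product-bound n v p^v∣∏ = begin
      v                                              ≤⟨ Val≤⇒≤ (Val≤-prodUpTo n) p^v∣∏ ⟩
      ∑< n val                                       ≤⟨ ∑-mono n (λ k k<n → ≤-∑-layers J (p^val∣W k) (val≤J k<n)) ⟩
      ∑[ k < n ] ∑[ i < J ] 𝟙 (p ^ suc i ∣? W k)     ≡⟨ ∑-comm n J _ ⟩
      ∑[ i < J ] N (suc i) n                         ≤⟨ layers-sum n (n * K) ⟩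
      B * n + suc D * d * (n * K + n)                ≡⟨ collect B (suc D * d) n K ⟩
      C * n                                          ∎
      where
      open ≤-Reasoning
      J : ℕ
      J = B + suc D * (n * K)
      val≤J : ∀ {k} → k < n → val k ≤ J
      val≤J {k} k<n = ≤-trans (<⇒≤ (val< k))
        (≤-trans (*-monoˡ-≤ K k<n) (≤-trans (m≤n*m (n * K) (suc D)) (m≤n+m _ B)))
      collect : ∀ B E n K → B * n + E * (n * K + n) ≡ (B + E * suc K) * n
      collect = solve-∀

open import Data.Nat using (ℕ; _*_; _≤_; _>_)
open import Data.Nat.Primality using (Prime)
open import Data.Integer using (ℤ; +_)
open import Data.Product using (Σ; _×_)
open import Relation.Binary.PropositionalEquality using (_≢_)

open import Data.Nat using (_^_)
open import Data.Nat.Divisibility using (_∣_)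
open import Data.Nat.Primality using (prime)
open import Data.Integer using (∣_∣)
import Data.Integer.Properties as ℤP
open import Data.Product using (_,_)
open import Data.Sum using (inj₁; inj₂)
open import Data.Empty using (⊥-elim)
open import Relation.Binary.PropositionalEquality using (trans; sym; subst)
open Polynomials using (degree; prodUpTo-cong)

lemma3p2 : (f : Poly) → (∀ (k : ℕ) → eval f (+ k) ≢ + 0) →
           ∀ (p : ℕ) → Prime p →
           Σ ℕ (λ C → (C > 0) ×
             (∀ (n : ℕ) → n > 0 → ∀ (v : ℕ) → IsPadicVal p (prodUpTo f n) v → v ≤ C * n))
-- Matching on `prime` makes the nontriviality of p available as an instance.  Since
-- f(0) ≠ 0, f is not identically zero and agrees with some g of exact degree d.
lemma3p2 f f≢0 p p-prime@(prime _) with degree f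
... | inj₁ f≡0 = ⊥-elim (f≢0 0 (f≡0 (+ 0)))
... | inj₂ (d , g , deg-g , lead≢0 , g≡f) = C , C>0 , bound
  where
  open Layers p p-prime g d deg-g lead≢0
  g≢0 : ∀ k → W k ≢ 0
  g≢0 k ∣g[k]∣≡0 = f≢0 k (trans (sym (g≡f (+ k))) (ℤP.∣i∣≡0⇒i≡0 ∣g[k]∣≡0))
  bound : ∀ n → n > 0 → ∀ v → IsPadicVal p (prodUpTo f n) v → v ≤ C * n
  bound n _ v (p^v∣∏f , _) =
    product-bound g≢0 n v (subst (λ x → p ^ v ∣ ∣ x ∣) (sym (prodUpTo-cong g≡f n)) p^v∣∏f)
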